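{- For each $n$, the subspace ${\bf CQSym}_n$ of ${\bf PQSym}_n$ spanned by the elements ${\bf P}^\pi$ ($\pi$ a non-decreasing parking function of length $n$) is stable under the internal product $*$, i.e. ${\bf P}^\pi*{\bf P}^{\pi'}\in{\bf CQSym}_n$ for all such $\pi,\pi'$.
   Context: A parking function of length $n$ is a word ${\bf a}=a_1\cdots a_n$ of positive integers whose non-decreasing rearrangement ${\bf a}^\uparrow=a'_1\cdots a'_n$ satisfies $a'_i\le i$; ${\rm PF}_n$ is the set of these. Parkization: for a word $w=w_1\cdots w_n$ over a totally ordered set $B$ in which every element has an immediate successor, let $\delta(x,y)\in\mathbb{N}\cup\{\infty\}$ ($x<y$) be the number of successor steps from $x$ to $y$ ($\infty$ if never reached); with distinct letters $b_1<\cdots<b_k$ of $w$ set $p(b_1)=1$, $p(b_{j+1})=\min(p(b_j)+\delta(b_j,b_{j+1}),1+\#\{i:w_i\le b_j\})$, and ${\rm Park}(w)=p(w_1)\cdots p(w_n)$. For ${\bf a}',{\bf a}''\in{\rm PF}_n$, ${\bf a}'\otimes{\bf a}''$ is the word $(a'_1,a''_1)\cdots(a'_n,a''_n)$ over $\mathbb{Z}_{>0}^2$ with lexicographic order (successor of $(i,j)$ is $(i,j+1)$). ${\bf PQSym}_n$ has basis $({\bf F}_{\bf a})_{{\bf a}\in{\rm PF}_n}$ and internal product ${\bf F}_{{\bf a}'}*{\bf F}_{{\bf a}''}={\bf F}_{{\rm Park}({\bf a}'\otimes{\bf a}'')}$, extended bilinearly. For a non-decreasing parking function $\pi$, ${\bf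 P}^\pi=\sum_{{\bf a}:\,{\bf a}^\uparrow=\pi}{\bf F}_{\bf a}$. -}

module Defs where

open import Data.Bool using (Bool; true; false; _∧_; _∨_; if_then_else_)
open import Data.Nat using (ℕ; zero; suc; _+_; _∸_; _≤ᵇ_; _<ᵇ_; _≡ᵇ_; _⊓_)
open import Data.Product using (_×_; _,_; ∃)
open import Data.List using (List; []; _∷_; length; filter; map; concatMap; foldr)
open import Data.Vec using (Vec; []; _∷_; toList; zip)
open import Data.Vec.Properties using (≡-dec)
open import Data.Maybe using (Maybe; just; nothing)
open import Data.Integer using (ℤ; 0ℤ; 1ℤ) renaming (_+_ to _+ℤ_; _*_ to _*ℤ_)
import Data.Nat as N
open import Relation.Nullary using (does)
open import Relation.Nullary.Decidable using (⌊_⌋)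
open import Relation.Binary.PropositionalEquality using (_≡_)

insertBy : {A : Set} → (A → A → Bool) → A → List A → List A
insertBy le x [] = x ∷ []
insertBy le x (y ∷ ys) = if le x y then x ∷ y ∷ ys else y ∷ insertBy le x ys

sortBy : {A : Set} → (A → A → Bool) → List A → List A
sortBy le = foldr (insertBy le) []

sortℕ : List ℕ → List ℕ
sortℕ = sortBy _≤ᵇ_

parkCond : ℕ → List ℕ → Bool
parkCond i [] = true
parkCond i (x ∷ xs) = (1 ≤ᵇ x) ∧ (x ≤ᵇ i) ∧ parkCond (suc i) xs

isPF : {n : ℕ} → Vec ℕ n → Bool
isPF a = parkCond 1 (sortℕ (toList a))

listEq : List ℕ → List ℕ → Bool
listEq [] [] = true
listEq (x ∷ xs) (y ∷ ys) = (x ≡ᵇ y) ∧ listEq xs ys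
listEq _ _ = false

sortedIs : {n : ℕ} → Vec ℕ n → Vec ℕ n → Bool
sortedIs a b = listEq (sortℕ (toList a)) (toList b)

isNDPF : {n : ℕ} → Vec ℕ n → Bool
isNDPF a = isPF a ∧ sortedIs a a

range1 : ℕ → List ℕ
range1 zero = []
range1 (suc k) = suc k ∷ range1 k

allWords : (n m : ℕ) → List (Vec ℕ n)
allWords zero m = [] ∷ []
allWords (suc n) m = concatMap (λ w → map (λ x → x ∷ w) (range1 m)) (allWords n m)

-- PF_n (every parking function of length n has letters in {1,…,n})
PF : (n : ℕ) → List (Vec ℕ n)
PF n = filter (λ a → isPF a Data.Bool.≟ true) (allWords n n)
  where import Data.Bool

NDPF : (n : ℕ) → List (Vec ℕ n)
NDPF n = filter (λ a → isNDPF a Data.Bool.≟ true) (allWords n n)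
  where import Data.Bool

-- Parkization of words over ℤ_{>0}² with lexicographic order,
-- successor of (i , j) being (i , j + 1)

L : Set
L = ℕ × ℕ

leL : L → L → Bool
leL (i , j) (i' , j') = (i <ᵇ i') ∨ ((i ≡ᵇ i') ∧ (j ≤ᵇ j'))

eqL : L → L → Bool
eqL (i , j) (i' , j') = (i ≡ᵇ i') ∧ (j ≡ᵇ j')

-- δ(x , y) for x < y; nothing = ∞
δ : L → L → Maybe ℕ
δ (i , j) (i' , j') = if i ≡ᵇ i' then just (j' ∸ j) else nothing

dedup : List L → List L
dedup [] = []
dedup (x ∷ []) = x ∷ []
dedup (x ∷ y ∷ ys) = if eqL x y then dedup (y ∷ ys) else x ∷ dedup (y ∷ ys)

countLe : List L → L → ℕ
countLe w b = length (filter (λ x → leL x b Data.Bool.≟ true) w)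
  where import Data.Bool

-- given sorted distinct letters b_{j+1} … and the pair (b_j , p(b_j)),
-- compute the table of values p
assignRest : List L → L → ℕ → List L → List (L × ℕ)
assignRest w b p [] = []
assignRest w b p (b' ∷ bs) = (b' , p') ∷ assignRest w b' p' bs
  where
  bound : ℕ
  bound = suc (countLe w b)
  p' : ℕ
  p' with δ b b'
  ... | just d  = (p + d) ⊓ bound
  ... | nothing = bound

assign : List L → List (L × ℕ)
assign w with dedup (sortBy leL w)
... | [] = []
... | b₁ ∷ bs = (b₁ , 1) ∷ assignRest w b₁ 1 bs

lookupL : List (L × ℕ) → L → ℕ
lookupL [] x = 0
lookupL ((y , v) ∷ t) x = if eqL x y then v else lookupL t x

Park : {n : ℕ} → Vec L n → Vec ℕ n
Park {n} w = Data.Vec.map (lookupL (assign (toList w))) w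
  where import Data.Vec

_⊗_ : {n : ℕ} → Vec ℕ n → Vec ℕ n → Vec L n
a ⊗ b = zip a b

-- PQSym_n with integer coefficients: an element is given by its
-- coefficient function on words (coefficient of F_c for c ∈ PF_n).

PQSym : ℕ → Set
PQSym n = Vec ℕ n → ℤ

Σℤ : {A : Set} → List A → (A → ℤ) → ℤ
Σℤ xs f = foldr (λ x acc → f x +ℤ acc) 0ℤ xs

[_] : Bool → ℤ
[ true ] = 1ℤ
[ false ] = 0ℤ

F : {n : ℕ} → Vec ℕ n → PQSym n
F a c = [ ⌊ ≡-dec N._≟_ a c ⌋ ]

P : {n : ℕ} → Vec ℕ n → PQSym n
P {n} π c = Σℤ (PF n) (λ a → [ sortedIs a π ] *ℤ F a c)

_*_ : {n : ℕ} → PQSym n → PQSym n → PQSym n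
_*_ {n} x y c =
  Σℤ (PF n) (λ a → Σℤ (PF n) (λ b → (x a *ℤ y b) *ℤ F (Park (a ⊗ b)) c))

InCQSym : (n : ℕ) → PQSym n → Set
InCQSym n z = ∃ λ (λc : Vec ℕ n → ℤ) →
  ∀ (c : Vec ℕ n) → z c ≡ Σℤ (NDPF n) (λ π → λc π *ℤ P π c)

module Submission where

-- P^π is the indicator function of the parking functions whose sorted rearrangement is π, so
-- CQSym_n consists exactly of the elements that are invariant under permuting positions and
-- vanish off PF_n. Parkization depends only on the multiset of letters of a word, hence commutes
-- with permutations of positions; so the internal product of two invariant elements is invariant.
-- Moreover Park always yields a parking function: along the distinct letters b₁ < b₂ < ⋯ the
-- values p(b_j) are non-decreasing and p(b) ≤ 1 + #{i : w_i < b}, which is exactly the parking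
-- condition on the sorted image. So the product also vanishes off PF_n.

open import Defs
open import Algebra.Bundles using (CommutativeMonoid)
open import Data.Bool using (Bool; true; false; _∧_; not; if_then_else_)
open import Data.Bool.ListAction using (all)
import Data.Bool as Bool
open import Data.Bool.Properties using (∧-commutativeMonoid; ∧-conicalˡ; ∧-conicalʳ; ∧-identityʳ; not-injective)
open import Data.Empty using (⊥-elim)
open import Data.Integer using (ℤ; 0ℤ; 1ℤ) renaming (_+_ to _+ℤ_; _*_ to _*ℤ_)
import Data.Integer.Properties as ℤ
open import Data.Integer.Tactic.RingSolver using (solve-∀)
open import Data.List using (List; []; _∷_; _++_; map; concatMap; filter)
open import Data.List.Membership.Propositional using (_∈_)
open import Data.List.Relation.Unary.All as All using (All; []; _∷_)
import Data.List.Relation.Unary.All.Properties as All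
open import Data.List.Relation.Unary.AllPairs using (AllPairs; []; _∷_)
open import Data.List.Relation.Unary.Any using (here; there)
open import Data.Maybe using (just; nothing)
open import Data.Nat using (ℕ; zero; suc; _+_; _≤_; _<_; _≤ᵇ_; _≡ᵇ_; _⊓_; _≟_; _≤?_; _<?_; z≤n; s≤s)
open import Data.Nat.Properties
  using (≤-refl; ≤-trans; ≤-total; ≤-antisym; <-trans; <-irrefl; <-asym; <-cmp; n≮n;
         ≤∧≢⇒<; m<1+n⇒m≤n; m≤n⇒m≤1+n; m⊓n≤n; ⊓-glb; m≤m+n; +-suc; +-identityʳ; +-monoʳ-≤)
open import Data.Product using (_×_; _,_; proj₁; proj₂)
open import Data.Product.Relation.Binary.Lex.Strict
  using (×-decidable; ×-transitive; ×-total₂; ×-antisymmetric)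
open import Data.Product.Relation.Binary.Pointwise.NonDependent as Pointwise using (≡×≡⇒≡; ≡⇒≡×≡)
open import Data.Sum using (inj₂; [_,_]′)
open import Data.Vec using (Vec; []; _∷_; toList; zip)
import Data.Vec as Vec
open import Data.Vec.Properties using (≡-dec; toList-map)
open import Function using (_∘_; id)
open import Relation.Binary.Definitions
  using (Decidable; DecidableEquality; Reflexive; Transitive; Total; Antisymmetric)
open import Relation.Binary.PropositionalEquality hiding ([_])
open import Relation.Nullary using (¬_; Dec; yes; no; does)
open import Relation.Nullary.Decidable using (dec-true; dec-false; isYes≗does; map′)

open import Algebra.Properties.CommutativeSemigroup
  (CommutativeMonoid.commutativeSemigroup ∧-commutativeMonoid) using (x∙yz≈y∙xz)

does⇒ : {P : Set} (P? : Dec P) → does P? ≡ true → P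
does⇒ (yes p) _ = p

does≡false⇒¬ : {P : Set} (P? : Dec P) → does P? ≡ false → ¬ P
does≡false⇒¬ (no ¬p) _ = ¬p

∧-intro : ∀ {a b} → a ≡ true → b ≡ true → a ∧ b ≡ true
∧-intro refl refl = refl

≡ᵇ-sym : ∀ m n → (m ≡ᵇ n) ≡ (n ≡ᵇ m)
≡ᵇ-sym m n with m ≟ n
... | yes refl = refl
... | no m≢n = trans (dec-false (m ≟ n) m≢n) (sym (dec-false (n ≟ m) (m≢n ∘ sym)))

[]-∧ : ∀ a b → [ a ∧ b ] ≡ [ a ] *ℤ [ b ]
[]-∧ true b = sym (ℤ.*-identityˡ [ b ])
[]-∧ false b = sym (ℤ.*-zeroˡ [ b ])

[]-idem : ∀ b x → ([ b ] *ℤ x) *ℤ [ b ] ≡ [ b ] *ℤ x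
[]-idem true x = ℤ.*-identityʳ _
[]-idem false x = trans (ℤ.*-zeroʳ (0ℤ *ℤ x)) (sym (ℤ.*-zeroˡ x))

module _ {A : Set} where

  Σℤ-cong : (xs : List A) {f g : A → ℤ} → (∀ x → f x ≡ g x) → Σℤ xs f ≡ Σℤ xs g
  Σℤ-cong [] e = refl
  Σℤ-cong (x ∷ xs) e = cong₂ _+ℤ_ (e x) (Σℤ-cong xs e)

  Σℤ-zero : (xs : List A) {f : A → ℤ} → (∀ x → f x ≡ 0ℤ) → Σℤ xs f ≡ 0ℤ
  Σℤ-zero [] e = refl
  Σℤ-zero (x ∷ xs) e = cong₂ _+ℤ_ (e x) (Σℤ-zero xs e)

  Σℤ-++ : (xs ys : List A) (f : A → ℤ) → Σℤ (xs ++ ys) f ≡ Σℤ xs f +ℤ Σℤ ys f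
  Σℤ-++ [] ys f = sym (ℤ.+-identityˡ _)
  Σℤ-++ (x ∷ xs) ys f = trans (cong (f x +ℤ_) (Σℤ-++ xs ys f)) (sym (ℤ.+-assoc (f x) _ _))

  Σℤ-+ : (xs : List A) (f g : A → ℤ) → Σℤ xs (λ x → f x +ℤ g x) ≡ Σℤ xs f +ℤ Σℤ xs g
  Σℤ-+ [] f g = refl
  Σℤ-+ (x ∷ xs) f g =
    trans (cong (f x +ℤ g x +ℤ_) (Σℤ-+ xs f g)) (interchange (f x) (g x) (Σℤ xs f) (Σℤ xs g))
    where
    interchange : ∀ a b c d → (a +ℤ b) +ℤ (c +ℤ d) ≡ (a +ℤ c) +ℤ (b +ℤ d)
    interchange = solve-∀

  Σℤ-*ʳ : (xs : List A) (f : A → ℤ) (k : ℤ) → Σℤ xs (λ x → f x *ℤ k) ≡ Σℤ xs f *ℤ k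
  Σℤ-*ʳ [] f k = sym (ℤ.*-zeroˡ k)
  Σℤ-*ʳ (x ∷ xs) f k = trans (cong (f x *ℤ k +ℤ_) (Σℤ-*ʳ xs f k)) (sym (ℤ.*-distribʳ-+ k (f x) _))

  Σℤ-filter : (b : A → Bool) (xs : List A) (f : A → ℤ) →
    Σℤ (filter (λ a → b a Bool.≟ true) xs) f ≡ Σℤ xs (λ a → [ b a ] *ℤ f a)
  Σℤ-filter b [] f = refl
  Σℤ-filter b (x ∷ xs) f with b x
  ... | true = cong₂ _+ℤ_ (sym (ℤ.*-identityˡ (f x))) (Σℤ-filter b xs f)
  ... | false = trans (Σℤ-filter b xs f)
    (sym (trans (cong (_+ℤ Σℤ xs (λ a → [ b a ] *ℤ f a)) (ℤ.*-zeroˡ (f x))) (ℤ.+-identityˡ _)))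

module _ {A C : Set} where

  Σℤ-map : (h : A → C) (xs : List A) (f : C → ℤ) → Σℤ (map h xs) f ≡ Σℤ xs (f ∘ h)
  Σℤ-map h [] f = refl
  Σℤ-map h (x ∷ xs) f = cong (f (h x) +ℤ_) (Σℤ-map h xs f)

  Σℤ-concatMap : (g : A → List C) (xs : List A) (f : C → ℤ) →
    Σℤ (concatMap g xs) f ≡ Σℤ xs (λ x → Σℤ (g x) f)
  Σℤ-concatMap g [] f = refl
  Σℤ-concatMap g (x ∷ xs) f =
    trans (Σℤ-++ (g x) (concatMap g xs) f) (cong (Σℤ (g x) f +ℤ_) (Σℤ-concatMap g xs f))

  Σℤ-swap : (xs : List A) (ys : List C) (g : A → C → ℤ) →
    Σℤ xs (λ x → Σℤ ys (g x)) ≡ Σℤ ys (λ y → Σℤ xs (λ x → g x y))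
  Σℤ-swap [] ys g = sym (Σℤ-zero ys (λ _ → refl))
  Σℤ-swap (x ∷ xs) ys g =
    trans (cong (Σℤ ys (g x) +ℤ_) (Σℤ-swap xs ys g))
          (sym (Σℤ-+ ys (g x) (λ y → Σℤ xs (λ x′ → g x′ y))))

-- Permutations of positions

-- Generated by a transposition of the first two entries, lifting and composition: enough to
-- express insertion sort, and each generator visibly reindexes a sum over allWords.

data Perm : ℕ → Set where
  idₚ   : ∀ {n} → Perm n
  swapₚ : ∀ {n} → Perm (suc (suc n))
  liftₚ : ∀ {n} → Perm n → Perm (suc n)
  _∘ₚ_  : ∀ {n} → Perm n → Perm n → Perm n

act : {A : Set} {n : ℕ} → Perm n → Vec A n → Vec A n
act idₚ v = v
act swapₚ (x ∷ y ∷ v) = y ∷ x ∷ v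
act (liftₚ p) (x ∷ v) = x ∷ act p v
act (p ∘ₚ q) v = act p (act q v)

invₚ : {n : ℕ} → Perm n → Perm n
invₚ idₚ = idₚ
invₚ swapₚ = swapₚ
invₚ (liftₚ p) = liftₚ (invₚ p)
invₚ (p ∘ₚ q) = invₚ q ∘ₚ invₚ p

module _ {A : Set} where

  act-invₚ : {n : ℕ} (p : Perm n) (v : Vec A n) → act (invₚ p) (act p v) ≡ v
  act-invₚ idₚ v = refl
  act-invₚ swapₚ (x ∷ y ∷ v) = refl
  act-invₚ (liftₚ p) (x ∷ v) = cong (x ∷_) (act-invₚ p v)
  act-invₚ (p ∘ₚ q) v = trans (cong (act (invₚ q)) (act-invₚ p (act q v))) (act-invₚ q v)

  act-injective : {n : ℕ} (p : Perm n) {u v : Vec A n} → act p u ≡ act p v → u ≡ v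
  act-injective p {u} {v} e = trans (sym (act-invₚ p u)) (trans (cong (act (invₚ p)) e) (act-invₚ p v))

  map-act : {C : Set} {n : ℕ} (f : A → C) (p : Perm n) (v : Vec A n) →
    Vec.map f (act p v) ≡ act p (Vec.map f v)
  map-act f idₚ v = refl
  map-act f swapₚ (x ∷ y ∷ v) = refl
  map-act f (liftₚ p) (x ∷ v) = cong (f x ∷_) (map-act f p v)
  map-act f (p ∘ₚ q) v = trans (map-act f p (act q v)) (cong (act p) (map-act f q v))

  zip-act : {C : Set} {n : ℕ} (p : Perm n) (a : Vec A n) (b : Vec C n) →
    zip (act p a) (act p b) ≡ act p (zip a b)
  zip-act idₚ a b = refl
  zip-act swapₚ (x ∷ y ∷ a) (x′ ∷ y′ ∷ b) = refl
  zip-act (liftₚ p) (x ∷ a) (y ∷ b) = cong ((x , y) ∷_) (zip-act p a b)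
  zip-act (p ∘ₚ q) a b = trans (zip-act p (act q a) (act q b)) (cong (act p) (zip-act q a b))

  SwapInvariant : {B : Set} → (List A → B) → Set
  SwapInvariant g = (∀ x y l → g (x ∷ y ∷ l) ≡ g (y ∷ x ∷ l))
                  × (∀ x {l l′} → g l ≡ g l′ → g (x ∷ l) ≡ g (x ∷ l′))

  swapInvariant-act : {B : Set} {g : List A → B} → SwapInvariant g →
    {n : ℕ} (p : Perm n) (v : Vec A n) → g (toList (act p v)) ≡ g (toList v)
  swapInvariant-act inv idₚ v = refl
  swapInvariant-act inv swapₚ (x ∷ y ∷ v) = proj₁ inv y x (toList v)
  swapInvariant-act inv (liftₚ p) (x ∷ v) = proj₂ inv x (swapInvariant-act inv p v)
  swapInvariant-act inv (p ∘ₚ q) v = trans (swapInvariant-act inv p (act q v)) (swapInvariant-act inv q v)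

Σℤ-allWords-suc : ∀ n m (f : Vec ℕ (suc n) → ℤ) →
  Σℤ (allWords (suc n) m) f ≡ Σℤ (allWords n m) (λ w → Σℤ (range1 m) (λ x → f (x ∷ w)))
Σℤ-allWords-suc n m f =
  trans (Σℤ-concatMap (λ w → map (_∷ w) (range1 m)) (allWords n m) f)
        (Σℤ-cong (allWords n m) (λ w → Σℤ-map (_∷ w) (range1 m) f))

Σℤ-allWords-act : ∀ n m (p : Perm n) (f : Vec ℕ n → ℤ) →
  Σℤ (allWords n m) f ≡ Σℤ (allWords n m) (f ∘ act p)
Σℤ-allWords-act n m idₚ f = refl
Σℤ-allWords-act (suc (suc n)) m swapₚ f = begin
    Σℤ (allWords (suc (suc n)) m) f
  ≡⟨ trans (Σℤ-allWords-suc (suc n) m f)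
           (Σℤ-allWords-suc n m (λ w → Σℤ (range1 m) (λ x → f (x ∷ w)))) ⟩
    Σℤ (allWords n m) (λ w → Σℤ (range1 m) (λ y → Σℤ (range1 m) (λ x → f (x ∷ y ∷ w))))
  ≡⟨ Σℤ-cong (allWords n m) (λ w → Σℤ-swap (range1 m) (range1 m) (λ y x → f (x ∷ y ∷ w))) ⟩
    Σℤ (allWords n m) (λ w → Σℤ (range1 m) (λ y → Σℤ (range1 m) (λ x → f (y ∷ x ∷ w))))
  ≡⟨ sym (trans (Σℤ-allWords-suc (suc n) m (f ∘ act swapₚ))
                (Σℤ-allWords-suc n m (λ w → Σℤ (range1 m) (λ x → f (act swapₚ (x ∷ w)))))) ⟩
    Σℤ (allWords (suc (suc n)) m) (f ∘ act swapₚ)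
  ∎
  where open ≡-Reasoning
Σℤ-allWords-act (suc n) m (liftₚ p) f = begin
    Σℤ (allWords (suc n) m) f
  ≡⟨ Σℤ-allWords-suc n m f ⟩
    Σℤ (allWords n m) (λ w → Σℤ (range1 m) (λ x → f (x ∷ w)))
  ≡⟨ Σℤ-allWords-act n m p (λ w → Σℤ (range1 m) (λ x → f (x ∷ w))) ⟩
    Σℤ (allWords n m) (λ w → Σℤ (range1 m) (λ x → f (x ∷ act p w)))
  ≡⟨ sym (Σℤ-allWords-suc n m (f ∘ act (liftₚ p))) ⟩
    Σℤ (allWords (suc n) m) (f ∘ act (liftₚ p))
  ∎
  where open ≡-Reasoning
Σℤ-allWords-act n m (p ∘ₚ q) f = trans (Σℤ-allWords-act n m p f) (Σℤ-allWords-act n m q (f ∘ act p))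

record BoolTotalOrder (A : Set) : Set where
  field
    le         : A → A → Bool
    le-refl    : ∀ x → le x x ≡ true
    le-trans   : ∀ x y z → le x y ≡ true → le y z ≡ true → le x z ≡ true
    le-total   : ∀ x y → le x y ≡ false → le y x ≡ true
    le-antisym : ∀ x y → le x y ≡ true → le y x ≡ true → x ≡ y

boolTotalOrder : {A : Set} {_≼_ : A → A → Set} → Decidable _≼_ → Reflexive _≼_ → Transitive _≼_ →
  Total _≼_ → Antisymmetric _≡_ _≼_ → BoolTotalOrder A
boolTotalOrder _≼?_ refl′ trans′ total antisym = record
  { le         = λ x y → does (x ≼? y)
  ; le-refl    = λ x → dec-true (x ≼? x) refl′
  ; le-trans   = λ x y z p q → dec-true (x ≼? z) (trans′ (does⇒ (x ≼? y) p) (does⇒ (y ≼? z) q))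
  ; le-total   = λ x y p → dec-true (y ≼? x)
                   ([ (λ x≼y → ⊥-elim (does≡false⇒¬ (x ≼? y) p x≼y)) , id ]′ (total x y))
  ; le-antisym = λ x y p q → antisym (does⇒ (x ≼? y) p) (does⇒ (y ≼? x) q)
  }

module InsertionSort {A : Set} (O : BoolTotalOrder A) where
  open BoolTotalOrder O

  Sorted : List A → Set
  Sorted = AllPairs (λ x y → le x y ≡ true)

  insert-comm : ∀ x y l → insertBy le x (insertBy le y l) ≡ insertBy le y (insertBy le x l)
  insert-comm x y [] with le x y in xy | le y x in yx
  ... | true  | true  rewrite le-antisym x y xy yx = refl
  ... | true  | false = refl
  ... | false | true  = refl
  ... | false | false with () ← trans (sym (le-total x y xy)) yx
  insert-comm x y (z ∷ l) with le x z in xz | le y z in yz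
  insert-comm x y (z ∷ l) | true | true with le x y in xy | le y x in yx
  ... | true  | true  rewrite le-antisym x y xy yx = refl
  ... | true  | false rewrite yz = refl
  ... | false | true  rewrite xz = refl
  ... | false | false with () ← trans (sym (le-total x y xy)) yx
  insert-comm x y (z ∷ l) | true | false with le y x in yx
  ... | true with () ← trans (sym (le-trans y x z yx xz)) yz
  ... | false rewrite xz | yz = refl
  insert-comm x y (z ∷ l) | false | true with le x y in xy
  ... | true with () ← trans (sym (le-trans x y z xy yz)) xz
  ... | false rewrite xz | yz = refl
  insert-comm x y (z ∷ l) | false | false rewrite xz | yz = cong (z ∷_) (insert-comm x y l)

  sortBy-swapInvariant : SwapInvariant (sortBy le)
  sortBy-swapInvariant = (λ x y l → insert-comm x y (sortBy le l)) , λ x → cong (insertBy le x)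

  insert-All : ∀ {P : A → Set} x l → P x → All P l → All P (insertBy le x l)
  insert-All x [] px [] = px ∷ []
  insert-All x (y ∷ l) px (py ∷ pl) with le x y
  ... | true  = px ∷ py ∷ pl
  ... | false = py ∷ insert-All x l px pl

  insert-sorted : ∀ x l → Sorted l → Sorted (insertBy le x l)
  insert-sorted x [] [] = [] ∷ []
  insert-sorted x (y ∷ l) (y≤ ∷ s) with le x y in xy
  ... | true  = (xy ∷ All.map (le-trans x y _ xy) y≤) ∷ y≤ ∷ s
  ... | false = insert-All x l (le-total x y xy) y≤ ∷ insert-sorted x l s

  sortBy-sorted : ∀ l → Sorted (sortBy le l)
  sortBy-sorted [] = []
  sortBy-sorted (x ∷ l) = insert-sorted x (sortBy le l) (sortBy-sorted l)

  insert-head : ∀ x l → All (λ y → le x y ≡ true) l → insertBy le x l ≡ x ∷ l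
  insert-head x [] [] = refl
  insert-head x (y ∷ l) (xy ∷ _) rewrite xy = refl

  sorted⇒sortBy-id : ∀ l → Sorted l → sortBy le l ≡ l
  sorted⇒sortBy-id [] [] = refl
  sorted⇒sortBy-id (x ∷ l) (x≤ ∷ s) =
    trans (cong (insertBy le x) (sorted⇒sortBy-id l s)) (insert-head x l x≤)

  insertion : {n : ℕ} → A → Vec A n → Perm (suc n)
  insertion x [] = idₚ
  insertion x (y ∷ ys) = if le x y then idₚ else liftₚ (insertion x ys) ∘ₚ swapₚ

  toList-insertion : {n : ℕ} (x : A) (v : Vec A n) →
    toList (act (insertion x v) (x ∷ v)) ≡ insertBy le x (toList v)
  toList-insertion x [] = refl
  toList-insertion x (y ∷ v) with le x y
  ... | true  = refl
  ... | false = cong (y ∷_) (toList-insertion x v)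

  sorting : {n : ℕ} → Vec A n → Perm n
  sorting [] = idₚ
  sorting (x ∷ xs) = insertion x (act (sorting xs) xs) ∘ₚ liftₚ (sorting xs)

  sortVec : {n : ℕ} → Vec A n → Vec A n
  sortVec v = act (sorting v) v

  toList-sortVec : {n : ℕ} (v : Vec A n) → toList (sortVec v) ≡ sortBy le (toList v)
  toList-sortVec [] = refl
  toList-sortVec (x ∷ v) =
    trans (toList-insertion x (sortVec v)) (cong (insertBy le x) (toList-sortVec v))

  swapInvariant-sortBy : {B : Set} {g : List A → B} → SwapInvariant g →
    {n : ℕ} (v : Vec A n) → g (sortBy le (toList v)) ≡ g (toList v)
  swapInvariant-sortBy {g = g} inv v =
    trans (cong g (sym (toList-sortVec v))) (swapInvariant-act inv (sorting v) v)

≤ᵇ-order : BoolTotalOrder ℕ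
≤ᵇ-order = boolTotalOrder _≤?_ ≤-refl ≤-trans ≤-total ≤-antisym

-- The comparisons of ≤ᵇ-order and lex-order are definitionally _≤ᵇ_ and leL, and does (x ≟ₗ y)
-- is definitionally eqL x y: sorting with these instances is literally sortℕ and sortBy leL.
lex-order : BoolTotalOrder L
lex-order = boolTotalOrder (×-decidable _≟_ _<?_ _≤?_) (inj₂ (refl , ≤-refl))
  (×-transitive {_≈₁_ = _≡_} {_<₂_ = _≤_} isEquivalence (resp₂ _<_) <-trans ≤-trans)
  (×-total₂ {_≈₁_ = _≡_} sym <-cmp ≤-total)
  (λ p q → ≡×≡⇒≡ (×-antisymmetric {_≈₁_ = _≡_} {_≈₂_ = _≡_} {_<₂_ = _≤_}
                                    sym <-irrefl <-asym ≤-antisym p q))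

module Sortℕ = InsertionSort ≤ᵇ-order
module SortL = InsertionSort lex-order
open BoolTotalOrder lex-order using () renaming (le-refl to leL-refl; le-trans to leL-trans;
  le-total to leL-total; le-antisym to leL-antisym)

_≟ₗ_ : DecidableEquality L
x ≟ₗ y = map′ ≡×≡⇒≡ ≡⇒≡×≡ (Pointwise.×-decidable _≟_ _≟_ x y)

eqL⇒≡ : ∀ {x y} → eqL x y ≡ true → x ≡ y
eqL⇒≡ {x} {y} = does⇒ (x ≟ₗ y)

eqL⇒≢ : ∀ {x y} → eqL x y ≡ false → x ≢ y
eqL⇒≢ {x} {y} = does≡false⇒¬ (x ≟ₗ y)

isPF-act : {n : ℕ} (p : Perm n) (a : Vec ℕ n) → isPF (act p a) ≡ isPF a
isPF-act p a = cong (parkCond 1) (swapInvariant-act Sortℕ.sortBy-swapInvariant p a)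

sortedIs-act : {n : ℕ} (p : Perm n) (a π : Vec ℕ n) → sortedIs (act p a) π ≡ sortedIs a π
sortedIs-act p a π = cong (λ s → listEq s (toList π)) (swapInvariant-act Sortℕ.sortBy-swapInvariant p a)

F-does : {n : ℕ} (a c : Vec ℕ n) → F a c ≡ [ does (≡-dec _≟_ a c) ]
F-does a c = cong [_] (isYes≗does (≡-dec _≟_ a c))

F-∷ : {n : ℕ} (x c₀ : ℕ) (a c : Vec ℕ n) → F (x ∷ a) (c₀ ∷ c) ≡ [ x ≡ᵇ c₀ ] *ℤ F a c
F-∷ x c₀ a c =
  trans (F-does (x ∷ a) (c₀ ∷ c)) (trans ([]-∧ (x ≡ᵇ c₀) _) (cong ([ x ≡ᵇ c₀ ] *ℤ_) (sym (F-does a c))))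

F-act : {n : ℕ} (p : Perm n) (a c : Vec ℕ n) → F (act p a) (act p c) ≡ F a c
F-act p a c = trans (F-does (act p a) (act p c)) (trans (cong [_] does-act) (sym (F-does a c)))
  where
  does-act : does (≡-dec _≟_ (act p a) (act p c)) ≡ does (≡-dec _≟_ a c)
  does-act with ≡-dec _≟_ a c
  ... | yes refl = dec-true (≡-dec _≟_ (act p a) (act p a)) refl
  ... | no a≢c = dec-false (≡-dec _≟_ (act p a) (act p c)) (a≢c ∘ act-injective p)

listEq-toList : {n : ℕ} (u v : Vec ℕ n) → listEq (toList u) (toList v) ≡ does (≡-dec _≟_ v u)
listEq-toList [] [] = refl
listEq-toList (x ∷ u) (y ∷ v) = cong₂ _∧_ (≡ᵇ-sym x y) (listEq-toList u v)

inRange : ℕ → ℕ → Bool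
inRange m x = (1 ≤ᵇ x) ∧ (x ≤ᵇ m)

inRange-suc : ∀ m c → c ≢ suc m → inRange (suc m) c ≡ inRange m c
inRange-suc m c c≢ with c ≤? m
... | yes c≤m = cong ((1 ≤ᵇ c) ∧_)
  (trans (dec-true (c ≤? suc m) (m≤n⇒m≤1+n c≤m)) (sym (dec-true (c ≤? m) c≤m)))
... | no c≰m = cong ((1 ≤ᵇ c) ∧_)
  (trans (dec-false (c ≤? suc m) (λ c≤ → c≰m (m<1+n⇒m≤n (≤∧≢⇒< c≤ c≢)))) (sym (dec-false (c ≤? m) c≰m)))

Σℤ-range1-sift : ∀ m c₀ (h : ℕ → ℤ) →
  Σℤ (range1 m) (λ x → [ x ≡ᵇ c₀ ] *ℤ h x) ≡ [ inRange m c₀ ] *ℤ h c₀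
Σℤ-range1-sift zero zero h = sym (ℤ.*-zeroˡ (h zero))
Σℤ-range1-sift zero (suc c₀) h = sym (ℤ.*-zeroˡ (h (suc c₀)))
Σℤ-range1-sift (suc m) c₀ h =
  trans (cong ([ suc m ≡ᵇ c₀ ] *ℤ h (suc m) +ℤ_) (Σℤ-range1-sift m c₀ h)) (split (c₀ ≟ suc m))
  where
  split : Dec (c₀ ≡ suc m) →
    [ suc m ≡ᵇ c₀ ] *ℤ h (suc m) +ℤ [ inRange m c₀ ] *ℤ h c₀ ≡ [ inRange (suc m) c₀ ] *ℤ h c₀
  split (yes refl)
    rewrite dec-true (m ≟ m) refl | dec-false (suc m ≤? m) (n≮n m) | dec-true (suc m ≤? suc m) ≤-refl =
    trans (cong (1ℤ *ℤ h (suc m) +ℤ_) (ℤ.*-zeroˡ (h (suc m)))) (ℤ.+-identityʳ _)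
  split (no c₀≢) rewrite dec-false (suc m ≟ c₀) (c₀≢ ∘ sym) | inRange-suc m c₀ c₀≢ =
    trans (cong (_+ℤ [ inRange m c₀ ] *ℤ h c₀) (ℤ.*-zeroˡ (h (suc m)))) (ℤ.+-identityˡ _)

Σℤ-allWords-sift : ∀ n m (g : Vec ℕ n → ℤ) (c : Vec ℕ n) →
  Σℤ (allWords n m) (λ a → g a *ℤ F a c) ≡ [ all (inRange m) (toList c) ] *ℤ g c
Σℤ-allWords-sift zero m g [] =
  trans (ℤ.+-identityʳ _) (trans (ℤ.*-identityʳ (g [])) (sym (ℤ.*-identityˡ (g []))))
Σℤ-allWords-sift (suc n) m g (c₀ ∷ c) = begin
    Σℤ (allWords (suc n) m) (λ a → g a *ℤ F a (c₀ ∷ c))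
  ≡⟨ Σℤ-allWords-suc n m (λ a → g a *ℤ F a (c₀ ∷ c)) ⟩
    Σℤ (allWords n m) (λ w → Σℤ (range1 m) (λ x → g (x ∷ w) *ℤ F (x ∷ w) (c₀ ∷ c)))
  ≡⟨ Σℤ-cong (allWords n m) (λ w → Σℤ-cong (range1 m) (λ x →
       trans (cong (g (x ∷ w) *ℤ_) (F-∷ x c₀ w c)) (reassoc (g (x ∷ w)) [ x ≡ᵇ c₀ ] (F w c)))) ⟩
    Σℤ (allWords n m) (λ w → Σℤ (range1 m) (λ x → ([ x ≡ᵇ c₀ ] *ℤ g (x ∷ w)) *ℤ F w c))
  ≡⟨ Σℤ-cong (allWords n m) (λ w →
       trans (Σℤ-*ʳ (range1 m) (λ x → [ x ≡ᵇ c₀ ] *ℤ g (x ∷ w)) (F w c))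
             (cong (_*ℤ F w c) (Σℤ-range1-sift m c₀ (λ x → g (x ∷ w))))) ⟩
    Σℤ (allWords n m) (λ w → ([ inRange m c₀ ] *ℤ g (c₀ ∷ w)) *ℤ F w c)
  ≡⟨ Σℤ-allWords-sift n m (λ w → [ inRange m c₀ ] *ℤ g (c₀ ∷ w)) c ⟩
    [ all (inRange m) (toList c) ] *ℤ ([ inRange m c₀ ] *ℤ g (c₀ ∷ c))
  ≡⟨ reassoc [ all (inRange m) (toList c) ] [ inRange m c₀ ] (g (c₀ ∷ c)) ⟩
    ([ inRange m c₀ ] *ℤ [ all (inRange m) (toList c) ]) *ℤ g (c₀ ∷ c)
  ≡⟨ cong (_*ℤ g (c₀ ∷ c)) (sym ([]-∧ (inRange m c₀) _)) ⟩
    [ all (inRange m) (toList (c₀ ∷ c)) ] *ℤ g (c₀ ∷ c)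
  ∎
  where
  open ≡-Reasoning
  reassoc : ∀ a b c → a *ℤ (b *ℤ c) ≡ (b *ℤ a) *ℤ c
  reassoc = solve-∀

Σℤ-filter-sift : ∀ n (b : Vec ℕ n → Bool) → (∀ c → b c ≡ true → all (inRange n) (toList c) ≡ true) →
  (g : Vec ℕ n → ℤ) (c : Vec ℕ n) →
  Σℤ (filter (λ a → b a Bool.≟ true) (allWords n n)) (λ a → g a *ℤ F a c) ≡ [ b c ] *ℤ g c
Σℤ-filter-sift n b b⇒inRange g c =
  trans (Σℤ-filter b (allWords n n) (λ a → g a *ℤ F a c))
  (trans (Σℤ-cong (allWords n n) (λ a → sym (ℤ.*-assoc [ b a ] (g a) (F a c))))
  (trans (Σℤ-allWords-sift n n (λ a → [ b a ] *ℤ g a) c) restrict))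
  where
  restrict : [ all (inRange n) (toList c) ] *ℤ ([ b c ] *ℤ g c) ≡ [ b c ] *ℤ g c
  restrict with b c in bc
  ... | true rewrite b⇒inRange c bc = ℤ.*-identityˡ (1ℤ *ℤ g c)
  ... | false = trans (cong ([ all (inRange n) (toList c) ] *ℤ_) (ℤ.*-zeroˡ (g c)))
                      (ℤ.*-zeroʳ [ all (inRange n) (toList c) ])

all-swapInvariant : {A : Set} (p : A → Bool) → SwapInvariant (all p)
all-swapInvariant p = (λ x y l → x∙yz≈y∙xz (p x) (p y) (all p l)) , λ x → cong (p x ∧_)

parkCond-inRange : ∀ {n} i m (v : Vec ℕ n) → parkCond i (toList v) ≡ true → i + n ≤ suc m →
  all (inRange m) (toList v) ≡ true
parkCond-inRange i m [] _ _ = refl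
parkCond-inRange {suc n} i m (x ∷ v) pc bound =
  ∧-intro (∧-intro one≤x (dec-true (x ≤? m) (≤-trans x≤i i≤m)))
          (parkCond-inRange (suc i) m v rest (subst (_≤ suc m) (+-suc i n) bound))
  where
  one≤x = ∧-conicalˡ (1 ≤ᵇ x) _ pc
  x≤i = does⇒ (x ≤? i) (∧-conicalˡ (x ≤ᵇ i) _ (∧-conicalʳ (1 ≤ᵇ x) _ pc))
  rest = ∧-conicalʳ (x ≤ᵇ i) _ (∧-conicalʳ (1 ≤ᵇ x) _ pc)
  i≤m : i ≤ m
  i≤m = ≤-trans (m≤m+n i n) (m<1+n⇒m≤n (subst (_≤ suc m) (+-suc i n) bound))

isPF⇒inRange : ∀ {n} (c : Vec ℕ n) → isPF c ≡ true → all (inRange n) (toList c) ≡ true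
isPF⇒inRange c pf =
  trans (sym (Sortℕ.swapInvariant-sortBy (all-swapInvariant (inRange _)) c))
  (trans (cong (all (inRange _)) (sym (Sortℕ.toList-sortVec c)))
         (parkCond-inRange 1 _ (Sortℕ.sortVec c)
                           (trans (cong (parkCond 1) (Sortℕ.toList-sortVec c)) pf) ≤-refl))

P-indicator : {n : ℕ} (π c : Vec ℕ n) → P π c ≡ [ isPF c ] *ℤ [ sortedIs c π ]
P-indicator {n} π c = Σℤ-filter-sift n isPF isPF⇒inRange (λ a → [ sortedIs a π ]) c

-- Parkization

countᵇ : {A : Set} → (A → Bool) → List A → ℕ
countᵇ p [] = 0
countᵇ p (x ∷ l) = if p x then suc (countᵇ p l) else countᵇ p l

module _ {A : Set} (p : A → Bool) where

  countᵇ-swapInvariant : SwapInvariant (countᵇ p)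
  countᵇ-swapInvariant = swap , λ x → cong (λ k → if p x then suc k else k)
    where
    swap : ∀ x y l → countᵇ p (x ∷ y ∷ l) ≡ countᵇ p (y ∷ x ∷ l)
    swap x y l with p x | p y
    ... | true  | true  = refl
    ... | true  | false = refl
    ... | false | true  = refl
    ... | false | false = refl

  countᵇ-mono : (q : A → Bool) → (∀ y → p y ≡ true → q y ≡ true) → ∀ l → countᵇ p l ≤ countᵇ q l
  countᵇ-mono q p⇒q [] = z≤n
  countᵇ-mono q p⇒q (x ∷ l) with p x in px | q x in qx
  ... | true  | true  = s≤s (countᵇ-mono q p⇒q l)
  ... | true  | false with () ← trans (sym (p⇒q x px)) qx
  ... | false | true  = m≤n⇒m≤1+n (countᵇ-mono q p⇒q l)
  ... | false | false = countᵇ-mono q p⇒q l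

  countᵇ-none : ∀ l → All (λ y → p y ≡ false) l → countᵇ p l ≡ 0
  countᵇ-none [] [] = refl
  countᵇ-none (x ∷ l) (px ∷ ps) rewrite px = countᵇ-none l ps

  countᵇ-∷ : ∀ x l → countᵇ p (x ∷ l) ≤ suc (countᵇ p l)
  countᵇ-∷ x l with p x
  ... | true  = ≤-refl
  ... | false = m≤n⇒m≤1+n ≤-refl

countLe-countᵇ : (w : List L) (b : L) → countLe w b ≡ countᵇ (λ x → leL x b) w
countLe-countᵇ [] b = refl
countLe-countᵇ (x ∷ w) b with leL x b
... | true  = cong suc (countLe-countᵇ w b)
... | false = countLe-countᵇ w b

countBelow : List L → L → ℕ
countBelow w x = countᵇ (λ y → not (leL x y)) w

_<ₗ_ : L → L → Set
x <ₗ y = leL x y ≡ true × x ≢ y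

countBelow≤countLe : ∀ w x → countBelow w x ≤ countLe w x
countBelow≤countLe w x = subst (countBelow w x ≤_) (sym (countLe-countᵇ w x))
  (countᵇ-mono _ _ (λ y x≰y → leL-total x y (not-injective x≰y)) w)

countLe≤countBelow : ∀ w {x y} → x <ₗ y → countLe w x ≤ countBelow w y
countLe≤countBelow w {x} {y} (x≤y , x≢y) = subst (_≤ countBelow w y) (sym (countLe-countᵇ w x))
  (countᵇ-mono _ _ z≤x⇒y≰z w)
  where
  z≤x⇒y≰z : ∀ z → leL z x ≡ true → not (leL y z) ≡ true
  z≤x⇒y≰z z z≤x with leL y z in y≤z
  ... | true  = ⊥-elim (x≢y (leL-antisym x y x≤y (leL-trans y z x y≤z z≤x)))
  ... | false = refl

dedup-∈ : ∀ {x} xs → x ∈ xs → x ∈ dedup xs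
dedup-∈ (y ∷ []) m = m
dedup-∈ (y ∷ z ∷ zs) m with eqL y z in y=z | (λ {x} → dedup-∈ {x} (z ∷ zs))
dedup-∈ (y ∷ z ∷ zs) (here refl) | true  | ih =
  subst (_∈ dedup (z ∷ zs)) (sym (eqL⇒≡ y=z)) (ih (here refl))
dedup-∈ (y ∷ z ∷ zs) (there m)   | true  | ih = ih m
dedup-∈ (y ∷ z ∷ zs) (here refl) | false | ih = here refl
dedup-∈ (y ∷ z ∷ zs) (there m)   | false | ih = there (ih m)

dedup-∈⁻ : ∀ {x} xs → x ∈ dedup xs → x ∈ xs
dedup-∈⁻ (y ∷ []) m = m
dedup-∈⁻ (y ∷ z ∷ zs) m with eqL y z | (λ {x} → dedup-∈⁻ {x} (z ∷ zs))
dedup-∈⁻ (y ∷ z ∷ zs) m         | true  | ih = there (ih m)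
dedup-∈⁻ (y ∷ z ∷ zs) (here px) | false | ih = here px
dedup-∈⁻ (y ∷ z ∷ zs) (there m) | false | ih = there (ih m)

dedup-strictlySorted : ∀ xs → SortL.Sorted xs → AllPairs _<ₗ_ (dedup xs)
dedup-strictlySorted [] [] = []
dedup-strictlySorted (x ∷ []) _ = [] ∷ []
dedup-strictlySorted (x ∷ y ∷ ys) (x≤ ∷ s@(y≤ ∷ _))
  with eqL x y in x=y | dedup-strictlySorted (y ∷ ys) s
... | true  | ih = ih
... | false | ih = All.tabulate x< ∷ ih
  where
  x< : ∀ {z} → z ∈ dedup (y ∷ ys) → x <ₗ z
  x< m with dedup-∈⁻ (y ∷ ys) m
  ... | here refl = All.head x≤ , eqL⇒≢ x=y
  ... | there m′ = All.lookup x≤ (there m′) , λ { refl →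
    eqL⇒≢ x=y (leL-antisym x y (All.head x≤) (All.lookup y≤ m′)) }

-- The value p(b′) that assignRest computes in a local where-block, exposed so it can be reasoned about.
nextValue : List L → L → ℕ → L → ℕ
nextValue w b p b′ with δ b b′
... | just d  = (p + d) ⊓ suc (countLe w b)
... | nothing = suc (countLe w b)

assignRest-∷ : ∀ w b p b′ bs →
  assignRest w b p (b′ ∷ bs) ≡ (b′ , nextValue w b p b′) ∷ assignRest w b′ (nextValue w b p b′) bs
assignRest-∷ w b p b′ bs with δ b b′
... | just d  = refl
... | nothing = refl

module _ {w w′ : List L} (same : ∀ b → countLe w b ≡ countLe w′ b) where

  nextValue-cong : ∀ b p b′ → nextValue w b p b′ ≡ nextValue w′ b p b′
  nextValue-cong b p b′ with δ b b′
  ... | just d  = cong (λ k → (p + d) ⊓ suc k) (same b)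
  ... | nothing = cong suc (same b)

  assignRest-cong : ∀ b p bs → assignRest w b p bs ≡ assignRest w′ b p bs
  assignRest-cong b p [] = refl
  assignRest-cong b p (b′ ∷ bs) = begin
      assignRest w b p (b′ ∷ bs)
    ≡⟨ assignRest-∷ w b p b′ bs ⟩
      (b′ , nextValue w b p b′) ∷ assignRest w b′ (nextValue w b p b′) bs
    ≡⟨ cong (λ q → (b′ , q) ∷ assignRest w b′ q bs) (nextValue-cong b p b′) ⟩
      (b′ , nextValue w′ b p b′) ∷ assignRest w b′ (nextValue w′ b p b′) bs
    ≡⟨ cong ((b′ , nextValue w′ b p b′) ∷_) (assignRest-cong b′ (nextValue w′ b p b′) bs) ⟩
      (b′ , nextValue w′ b p b′) ∷ assignRest w′ b′ (nextValue w′ b p b′) bs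
    ≡⟨ sym (assignRest-∷ w′ b p b′ bs) ⟩
      assignRest w′ b p (b′ ∷ bs)
    ∎
    where open ≡-Reasoning

table : List L → L → ℕ → List L → List (L × ℕ)
table w b p bs = (b , p) ∷ assignRest w b p bs

assignFrom : List L → List L → List (L × ℕ)
assignFrom w [] = []
assignFrom w (b ∷ bs) = table w b 1 bs

assign-assignFrom : ∀ w → assign w ≡ assignFrom w (dedup (sortBy leL w))
assign-assignFrom w with dedup (sortBy leL w)
... | []     = refl
... | b ∷ bs = refl

lookupL-head : ∀ b p T → lookupL ((b , p) ∷ T) b ≡ p
lookupL-head b p T rewrite dec-true (b ≟ₗ b) refl = refl

lookupL-tail : ∀ b p T {x} → x ≢ b → lookupL ((b , p) ∷ T) x ≡ lookupL T x
lookupL-tail b p T {x} x≢b rewrite dec-false (x ≟ₗ b) x≢b = refl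

module _ (w : List L) where

  nextValue-≤ : ∀ b p b′ → nextValue w b p b′ ≤ suc (countLe w b)
  nextValue-≤ b p b′ with δ b b′
  ... | just d  = m⊓n≤n (p + d) _
  ... | nothing = ≤-refl

  ≤-nextValue : ∀ b p b′ → p ≤ suc (countLe w b) → p ≤ nextValue w b p b′
  ≤-nextValue b p b′ p≤ with δ b b′
  ... | just d  = ⊓-glb (m≤m+n p d) p≤
  ... | nothing = p≤

  lookup-table-∷ : ∀ b p b′ bs {x} → x ≢ b →
    lookupL (table w b p (b′ ∷ bs)) x ≡ lookupL (table w b′ (nextValue w b p b′) bs) x
  lookup-table-∷ b p b′ bs {x} x≢b =
    trans (cong (λ T → lookupL ((b , p) ∷ T) x) (assignRest-∷ w b p b′ bs))
          (lookupL-tail b p (table w b′ (nextValue w b p b′) bs) x≢b)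

  table-bounds : ∀ b p bs → AllPairs _<ₗ_ (b ∷ bs) → p ≤ suc (countBelow w b) → ∀ {x} → x ∈ b ∷ bs →
    p ≤ lookupL (table w b p bs) x × lookupL (table w b p bs) x ≤ suc (countBelow w x)
  table-bounds b p bs _ p≤ (here refl) rewrite lookupL-head b p (assignRest w b p bs) = ≤-refl , p≤
  table-bounds b p (b′ ∷ bs) (b< ∷ s) p≤ {x} (there m) =
    subst (λ v → p ≤ v × v ≤ suc (countBelow w x)) (sym (lookup-table-∷ b p b′ bs x≢b))
      (≤-trans p≤p′ (proj₁ ih) , proj₂ ih)
    where
    x≢b = proj₂ (All.lookup b< m) ∘ sym
    p≤p′ = ≤-nextValue b p b′ (≤-trans p≤ (s≤s (countBelow≤countLe w b)))
    p′≤ = ≤-trans (nextValue-≤ b p b′) (s≤s (countLe≤countBelow w (All.head b<)))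
    ih = table-bounds b′ (nextValue w b p b′) bs s p′≤ m

  table-mono : ∀ b p bs → AllPairs _<ₗ_ (b ∷ bs) → p ≤ suc (countBelow w b) → ∀ {x y} →
    x ∈ b ∷ bs → y ∈ b ∷ bs → leL x y ≡ true → lookupL (table w b p bs) x ≤ lookupL (table w b p bs) y
  table-mono b p bs s p≤ (here refl) (here refl) _ = ≤-refl
  table-mono b p bs s p≤ (here refl) y∈ _ rewrite lookupL-head b p (assignRest w b p bs) =
    proj₁ (table-bounds b p bs s p≤ y∈)
  table-mono b p bs (b< ∷ _) p≤ (there x∈) (here refl) x≤b =
    ⊥-elim (proj₂ (All.lookup b< x∈) (leL-antisym _ _ (proj₁ (All.lookup b< x∈)) x≤b))
  table-mono b p (b′ ∷ bs) (b< ∷ s) p≤ (there x∈) (there y∈) x≤y =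
    subst₂ _≤_ (sym (lookup-table-∷ b p b′ bs (x≢b x∈))) (sym (lookup-table-∷ b p b′ bs (x≢b y∈)))
      (table-mono b′ (nextValue w b p b′) bs s p′≤ x∈ y∈ x≤y)
    where
    x≢b : ∀ {x} → x ∈ b′ ∷ bs → x ≢ b
    x≢b m = proj₂ (All.lookup b< m) ∘ sym
    p′≤ = ≤-trans (nextValue-≤ b p b′) (s≤s (countLe≤countBelow w (All.head b<)))

  private
    D = dedup (sortBy leL w)
    D-strict = dedup-strictlySorted (sortBy leL w) (SortL.sortBy-sorted w)

  assignFrom-bounds : ∀ bs → AllPairs _<ₗ_ bs → ∀ {x} → x ∈ bs →
    1 ≤ lookupL (assignFrom w bs) x × lookupL (assignFrom w bs) x ≤ suc (countBelow w x)
  assignFrom-bounds (b ∷ bs) s = table-bounds b 1 bs s (s≤s z≤n)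

  assignFrom-mono : ∀ bs → AllPairs _<ₗ_ bs → ∀ {x y} → x ∈ bs → y ∈ bs → leL x y ≡ true →
    lookupL (assignFrom w bs) x ≤ lookupL (assignFrom w bs) y
  assignFrom-mono (b ∷ bs) s = table-mono b 1 bs s (s≤s z≤n)

  assign-bounds : ∀ {x} → x ∈ sortBy leL w →
    1 ≤ lookupL (assign w) x × lookupL (assign w) x ≤ suc (countBelow w x)
  assign-bounds {x} m = subst (λ T → 1 ≤ lookupL T x × lookupL T x ≤ suc (countBelow w x))
    (sym (assign-assignFrom w)) (assignFrom-bounds D D-strict (dedup-∈ _ m))

  assign-mono : ∀ {x y} → x ∈ sortBy leL w → y ∈ sortBy leL w → leL x y ≡ true →
    lookupL (assign w) x ≤ lookupL (assign w) y
  assign-mono {x} {y} mx my x≤y = subst (λ T → lookupL T x ≤ lookupL T y) (sym (assign-assignFrom w))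
    (assignFrom-mono D D-strict (dedup-∈ _ mx) (dedup-∈ _ my) x≤y)

-- i is the number of letters already consumed in front of the sorted suffix s.
parkCond-map : (f : L → ℕ) (i : ℕ) (s : List L) → SortL.Sorted s →
  (∀ {x} → x ∈ s → 1 ≤ f x × f x ≤ suc (i + countBelow s x)) → parkCond (suc i) (map f s) ≡ true
parkCond-map f i [] _ _ = refl
parkCond-map f i (x ∷ s) (x≤ ∷ sorted) bounds =
  ∧-intro (dec-true (1 ≤? f x) (proj₁ (bounds (here refl))))
  (∧-intro (dec-true (f x ≤? suc i) fx≤)
           (parkCond-map f (suc i) s sorted bounds′))
  where
  nothing-below : countBelow (x ∷ s) x ≡ 0
  nothing-below rewrite leL-refl x = countᵇ-none _ s (All.map (cong not) x≤)
  fx≤ : f x ≤ suc i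
  fx≤ = subst (λ k → f x ≤ suc k) (trans (cong (i +_) nothing-below) (+-identityʳ i)) (proj₂ (bounds (here refl)))
  bounds′ : ∀ {y} → y ∈ s → 1 ≤ f y × f y ≤ suc (suc i + countBelow s y)
  bounds′ {y} m = proj₁ (bounds (there m)) ,
    ≤-trans (proj₂ (bounds (there m)))
            (s≤s (subst (i + countBelow (x ∷ s) y ≤_) (+-suc i (countBelow s y))
                        (+-monoʳ-≤ i (countᵇ-∷ _ x s))))

map-sorted : (g : L → ℕ) (s : List L) → SortL.Sorted s →
  (∀ {x y} → x ∈ s → y ∈ s → leL x y ≡ true → g x ≤ g y) → Sortℕ.Sorted (map g s)
map-sorted g [] [] _ = []
map-sorted g (x ∷ s) (x≤ ∷ sorted) mono =
  All.map⁺ (All.tabulate (λ {y} m → dec-true (g x ≤? g y) (mono (here refl) (there m) (All.lookup x≤ m))))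
  ∷ map-sorted g s sorted (λ mx my → mono (there mx) (there my))

Park-isPF : {n : ℕ} (w : Vec L n) → isPF (Park w) ≡ true
Park-isPF w = begin
    isPF (Vec.map f w)
  ≡⟨ sym (isPF-act q (Vec.map f w)) ⟩
    isPF (act q (Vec.map f w))
  ≡⟨ cong isPF (sym (map-act f q w)) ⟩
    isPF (Vec.map f (SortL.sortVec w))
  ≡⟨ cong (parkCond 1 ∘ sortℕ) (trans (toList-map f (SortL.sortVec w)) (cong (map f) (SortL.toList-sortVec w))) ⟩
    parkCond 1 (sortℕ (map f S))
  ≡⟨ cong (parkCond 1) (Sortℕ.sorted⇒sortBy-id (map f S)
                          (map-sorted f S (SortL.sortBy-sorted l) (assign-mono l))) ⟩
    parkCond 1 (map f S)
  ≡⟨ parkCond-map f 0 S (SortL.sortBy-sorted l) bounds ⟩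
    true
  ∎
  where
  open ≡-Reasoning
  l = toList w
  q = SortL.sorting w
  f = lookupL (assign l)
  S = sortBy leL l
  bounds : ∀ {x} → x ∈ S → 1 ≤ f x × f x ≤ suc (countBelow S x)
  bounds {x} m = subst (λ k → 1 ≤ f x × f x ≤ suc k)
    (sym (SortL.swapInvariant-sortBy (countᵇ-swapInvariant (λ y → not (leL x y))) w)) (assign-bounds l m)

assign-act : {n : ℕ} (p : Perm n) (w : Vec L n) → assign (toList (act p w)) ≡ assign (toList w)
assign-act p w = begin
    assign (toList (act p w))
  ≡⟨ assign-assignFrom (toList (act p w)) ⟩
    assignFrom (toList (act p w)) (dedup (sortBy leL (toList (act p w))))
  ≡⟨ cong (assignFrom (toList (act p w)) ∘ dedup) (swapInvariant-act SortL.sortBy-swapInvariant p w) ⟩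
    assignFrom (toList (act p w)) (dedup (sortBy leL (toList w)))
  ≡⟨ assignFrom-cong (dedup (sortBy leL (toList w))) ⟩
    assignFrom (toList w) (dedup (sortBy leL (toList w)))
  ≡⟨ sym (assign-assignFrom (toList w)) ⟩
    assign (toList w)
  ∎
  where
  open ≡-Reasoning
  same : ∀ b → countLe (toList (act p w)) b ≡ countLe (toList w) b
  same b = trans (countLe-countᵇ (toList (act p w)) b)
    (trans (swapInvariant-act (countᵇ-swapInvariant (λ x → leL x b)) p w) (sym (countLe-countᵇ (toList w) b)))
  assignFrom-cong : ∀ bs → assignFrom (toList (act p w)) bs ≡ assignFrom (toList w) bs
  assignFrom-cong [] = refl
  assignFrom-cong (b ∷ bs) = cong ((b , 1) ∷_) (assignRest-cong same b 1 bs)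

Park-act : {n : ℕ} (p : Perm n) (w : Vec L n) → Park (act p w) ≡ act p (Park w)
Park-act p w = trans (cong (λ T → Vec.map (lookupL T) (act p w)) (assign-act p w)) (map-act _ p w)

-- Symmetric elements of PQSym

Symmetric : {n : ℕ} → PQSym n → Set
Symmetric {n} z = (p : Perm n) (c : Vec ℕ n) → z (act p c) ≡ z c

VanishesOffPF : {n : ℕ} → PQSym n → Set
VanishesOffPF z = ∀ c → isPF c ≡ false → z c ≡ 0ℤ

P-symmetric : {n : ℕ} (π : Vec ℕ n) → Symmetric (P π)
P-symmetric π p c = begin
    P π (act p c)
  ≡⟨ P-indicator π (act p c) ⟩
    [ isPF (act p c) ] *ℤ [ sortedIs (act p c) π ]
  ≡⟨ cong₂ (λ a b → [ a ] *ℤ [ b ]) (isPF-act p c) (sortedIs-act p c π) ⟩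
    [ isPF c ] *ℤ [ sortedIs c π ]
  ≡⟨ sym (P-indicator π c) ⟩
    P π c
  ∎
  where open ≡-Reasoning

Σℤ-PF-act : {n : ℕ} (p : Perm n) (f : Vec ℕ n → ℤ) → Σℤ (PF n) f ≡ Σℤ (PF n) (f ∘ act p)
Σℤ-PF-act {n} p f =
  trans (Σℤ-filter isPF (allWords n n) f)
  (trans (Σℤ-allWords-act n n p (λ a → [ isPF a ] *ℤ f a))
  (trans (Σℤ-cong (allWords n n) (λ a → cong (λ b → [ b ] *ℤ f (act p a)) (isPF-act p a)))
         (sym (Σℤ-filter isPF (allWords n n) (f ∘ act p)))))

*-symmetric : {n : ℕ} {x y : PQSym n} → Symmetric x → Symmetric y → Symmetric (x * y)
*-symmetric {n} {x} {y} x-sym y-sym p c =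
  trans (Σℤ-PF-act p (λ a → Σℤ (PF n) (λ b → term a b)))
  (Σℤ-cong (PF n) (λ a → trans (Σℤ-PF-act p (term (act p a)))
  (Σℤ-cong (PF n) (λ b → cong₂ _*ℤ_ (cong₂ _*ℤ_ (x-sym p a) (y-sym p b)) (F-Park-act a b)))))
  where
  term : Vec ℕ n → Vec ℕ n → ℤ
  term a b = (x a *ℤ y b) *ℤ F (Park (a ⊗ b)) (act p c)
  F-Park-act : ∀ a b → F (Park (act p a ⊗ act p b)) (act p c) ≡ F (Park (a ⊗ b)) c
  F-Park-act a b =
    trans (cong (λ u → F u (act p c)) (trans (cong Park (zip-act p a b)) (Park-act p (a ⊗ b))))
          (F-act p (Park (a ⊗ b)) c)

*-vanishesOffPF : {n : ℕ} (x y : PQSym n) → VanishesOffPF (x * y)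
*-vanishesOffPF {n} x y c c∉PF = Σℤ-zero (PF n) (λ a → Σℤ-zero (PF n) (λ b →
  trans (cong ((x a *ℤ y b) *ℤ_)
              (trans (F-does (Park (a ⊗ b)) c) (cong [_] (dec-false (≡-dec _≟_ _ c) (Park≢ a b)))))
        (ℤ.*-zeroʳ (x a *ℤ y b))))
  where
  Park≢ : ∀ a b → Park (a ⊗ b) ≢ c
  Park≢ a b refl with () ← trans (sym (Park-isPF (a ⊗ b))) c∉PF

sortedIs-F : {n : ℕ} (c π : Vec ℕ n) → [ sortedIs c π ] ≡ F π (Sortℕ.sortVec c)
sortedIs-F c π = begin
    [ listEq (sortℕ (toList c)) (toList π) ]
  ≡⟨ cong (λ l → [ listEq l (toList π) ]) (sym (Sortℕ.toList-sortVec c)) ⟩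
    [ listEq (toList (Sortℕ.sortVec c)) (toList π) ]
  ≡⟨ cong [_] (listEq-toList (Sortℕ.sortVec c) π) ⟩
    [ does (≡-dec _≟_ π (Sortℕ.sortVec c)) ]
  ≡⟨ sym (F-does π (Sortℕ.sortVec c)) ⟩
    F π (Sortℕ.sortVec c)
  ∎
  where open ≡-Reasoning

isNDPF-sortVec : {n : ℕ} (c : Vec ℕ n) → isNDPF (Sortℕ.sortVec c) ≡ isPF c
isNDPF-sortVec c = trans (cong₂ _∧_ (isPF-act (Sortℕ.sorting c) c) s-sorted) (∧-identityʳ (isPF c))
  where
  s = Sortℕ.sortVec c
  s-sorted : sortedIs s s ≡ true
  s-sorted = begin
      listEq (sortℕ (toList s)) (toList s)
    ≡⟨ cong (λ l → listEq l (toList s)) (Sortℕ.sorted⇒sortBy-id (toList s)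
         (subst Sortℕ.Sorted (sym (Sortℕ.toList-sortVec c)) (Sortℕ.sortBy-sorted (toList c)))) ⟩
      listEq (toList s) (toList s)
    ≡⟨ listEq-toList s s ⟩
      does (≡-dec _≟_ s s)
    ≡⟨ dec-true (≡-dec _≟_ s s) refl ⟩
      true
    ∎
    where open ≡-Reasoning

P-expansion : {n : ℕ} (z : PQSym n) → Symmetric z → (c : Vec ℕ n) →
  Σℤ (NDPF n) (λ π → z π *ℤ P π c) ≡ [ isPF c ] *ℤ z c
P-expansion {n} z z-sym c = begin
    Σℤ (NDPF n) (λ π → z π *ℤ P π c)
  ≡⟨ Σℤ-cong (NDPF n) (λ π → trans (cong (z π *ℤ_) (P-sifted π)) (swap-last (z π) [ isPF c ] (F π s))) ⟩
    Σℤ (NDPF n) (λ π → (z π *ℤ F π s) *ℤ [ isPF c ])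
  ≡⟨ Σℤ-*ʳ (NDPF n) (λ π → z π *ℤ F π s) [ isPF c ] ⟩
    Σℤ (NDPF n) (λ π → z π *ℤ F π s) *ℤ [ isPF c ]
  ≡⟨ cong (_*ℤ [ isPF c ]) (Σℤ-filter-sift n isNDPF NDPF⇒inRange z s) ⟩
    ([ isNDPF s ] *ℤ z s) *ℤ [ isPF c ]
  ≡⟨ cong₂ (λ b v → ([ b ] *ℤ v) *ℤ [ isPF c ]) (isNDPF-sortVec c) (z-sym (Sortℕ.sorting c) c) ⟩
    ([ isPF c ] *ℤ z c) *ℤ [ isPF c ]
  ≡⟨ []-idem (isPF c) (z c) ⟩
    [ isPF c ] *ℤ z c
  ∎
  where
  open ≡-Reasoning
  s = Sortℕ.sortVec c
  P-sifted : ∀ π → P π c ≡ [ isPF c ] *ℤ F π s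
  P-sifted π = trans (P-indicator π c) (cong ([ isPF c ] *ℤ_) (sortedIs-F c π))
  NDPF⇒inRange : ∀ a → isNDPF a ≡ true → all (inRange n) (toList a) ≡ true
  NDPF⇒inRange a nd = isPF⇒inRange a (∧-conicalˡ (isPF a) _ nd)
  swap-last : ∀ a b d → a *ℤ (b *ℤ d) ≡ (a *ℤ d) *ℤ b
  swap-last = solve-∀

vanishesOffPF-indicator : {n : ℕ} (z : PQSym n) → VanishesOffPF z → ∀ c → [ isPF c ] *ℤ z c ≡ z c
vanishesOffPF-indicator z vanish c with isPF c in pf
... | true  = ℤ.*-identityˡ (z c)
... | false = trans (ℤ.*-zeroˡ (z c)) (sym (vanish c pf))

symmetric⇒InCQSym : {n : ℕ} (z : PQSym n) → Symmetric z → VanishesOffPF z → InCQSym n z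
symmetric⇒InCQSym z z-sym vanish =
  z , λ c → sym (trans (P-expansion z z-sym c) (vanishesOffPF-indicator z vanish c))

mainTheorem2 : (n : ℕ) (π π' : Vec ℕ n) → isNDPF π ≡ true → isNDPF π' ≡ true →
    InCQSym n (P π * P π')
mainTheorem2 n π π' _ _ =
  symmetric⇒InCQSym (P π * P π')
    (*-symmetric (P-symmetric π) (P-symmetric π'))
    (*-vanishesOffPF (P π) (P π'))
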